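{- Let $n=2^k+r$ with $k\ge 0$ and $0\le r<2^k$. The maximal number of $S$-nodes of a full binary tree with $n$ leaves is $n-\omega(n)$, where $\omega(n)$ is the number of $1$s in the binary expansion of $n$; moreover the tree obtained by joining, as the two children of a new root, a perfect binary tree with $2^k$ leaves and (recursively) such a maximal tree with $r$ leaves (when $r>0$; when $r=0$ the perfect tree with $2^k$ leaves itself) has $n-\omega(n)$ $S$-nodes.
   Context: A full binary tree is a rooted tree in which every node has $0$ or $2$ children. An internal node is an $S$-node if its two children have the same number of descendant leaves, and a $D$-node otherwise. A perfect binary tree with $2^k$ leaves is the full binary tree with all leaves at depth $k$. -}

module Defs where

open import Data.Nat using (ℕ; zero; suc; _+_; _∸_; _^_; _≟_; _/_; _%_)
open import Data.Nat.Logarithm using (⌊log₂_⌋)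
open import Relation.Nullary using (yes; no)

data Tree : Set where
  leaf : Tree
  node : Tree → Tree → Tree

leaves : Tree → ℕ
leaves leaf = 1
leaves (node l r) = leaves l + leaves r

snodes : Tree → ℕ
snodes leaf = 0
snodes (node l r) with leaves l ≟ leaves r
... | yes _ = suc (snodes l + snodes r)
... | no  _ = snodes l + snodes r

perfect : ℕ → Tree
perfect zero = leaf
perfect (suc k) = node (perfect k) (perfect k)

-- ω(n): number of 1s in the binary expansion of n (fuel = n suffices)
ωfuel : ℕ → ℕ → ℕ
ωfuel zero n = 0
ωfuel (suc f) n = n % 2 + ωfuel f (n / 2)

ω : ℕ → ℕ
ω n = ωfuel n n

-- The tree of the statement: for n = 2^k + r (0 ≤ r < 2^k),
-- perfect k if r = 0, otherwise node (perfect k) (optTree r).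
-- (fuel = n suffices since r < n)
optTreeFuel : ℕ → ℕ → Tree
optTreeFuel zero n = leaf
optTreeFuel (suc f) n with n ∸ 2 ^ ⌊log₂ n ⌋
... | zero = perfect ⌊log₂ n ⌋
... | suc r = node (perfect ⌊log₂ n ⌋) (optTreeFuel f (suc r))

optTree : ℕ → Tree
optTree n = optTreeFuel n n

{-# OPTIONS --safe #-}
-- Every full binary tree t with n leaves satisfies snodes t + ω n ≤ n, by induction on t.
-- At an S-node both subtrees have a leaves, ω (a + a) = ω a, and ω a ≥ 1 pays for the
-- new S-node; at a D-node it is subadditivity, ω (a + b) ≤ ω a + ω b (binary addition
-- with carries). Equality holds for the perfect tree (2 ^ k - 1 S-nodes, ω (2 ^ k) = 1)
-- and survives grafting it next to an optimal tree with r < 2 ^ k leaves: the new root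
-- is a D-node and ω (2 ^ k + r) = 1 + ω r.
module Submission where

open import Data.Empty using (⊥-elim)
open import Data.Nat using (ℕ; zero; suc; _+_; _*_; _∸_; _^_; _≤_; _<_; z≤n; s≤s; s≤s⁻¹; z<s; _≟_; _/_; _%_; ⌊_/2⌋; ⌈_/2⌉)
open import Data.Nat.DivMod using (m/n<m; m*n%n≡0; m*n/n≡m; [m+kn]%n≡m%n; +-distrib-/)
open import Data.Nat.Logarithm using (⌊log₂_⌋; ⌊log₂⌋-mono-≤; ⌊log₂⌊n/2⌋⌋≡⌊log₂n⌋∸1; ⌊log₂[2^n]⌋≡n)
open import Data.Nat.Properties
open import Data.Nat.Solver using (module +-*-Solver)
open import Data.Product using (_×_; ∃-syntax; _,_; proj₁; proj₂)
open import Data.Sum using (inj₁; inj₂)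
open import Function using (_∘_)
open import Relation.Binary.PropositionalEquality
open import Relation.Nullary using (yes; no)
open +-*-Solver using (solve; _:=_; _:+_; _:*_; con)

open import Defs

ωfuel-0 : ∀ f → ωfuel f 0 ≡ 0
ωfuel-0 zero = refl
ωfuel-0 (suc f) = ωfuel-0 f

n≤1+f⇒n/2≤f : ∀ {n f} → n ≤ suc f → n / 2 ≤ f
n≤1+f⇒n/2≤f {zero} _ = z≤n
n≤1+f⇒n/2≤f {suc n} (s≤s n≤f) = ≤-trans (s≤s⁻¹ (m/n<m (suc n) 2 (s≤s (s≤s z≤n)))) n≤f

ωfuel-irrelevant : ∀ {f g n} → n ≤ f → n ≤ g → ωfuel f n ≡ ωfuel g n
ωfuel-irrelevant {zero} {g} z≤n _ = sym (ωfuel-0 g)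
ωfuel-irrelevant {suc f} {zero} _ z≤n = ωfuel-0 (suc f)
ωfuel-irrelevant {suc f} {suc g} {n} n≤f n≤g =
  cong (n % 2 +_) (ωfuel-irrelevant (n≤1+f⇒n/2≤f n≤f) (n≤1+f⇒n/2≤f n≤g))

ω-unfold : ∀ n → ω n ≡ n % 2 + ω (n / 2)
ω-unfold zero = refl
ω-unfold (suc n) = cong (suc n % 2 +_) (ωfuel-irrelevant {n} (n≤1+f⇒n/2≤f ≤-refl) ≤-refl)

ω[n*2]≡ω[n] : ∀ n → ω (n * 2) ≡ ω n
ω[n*2]≡ω[n] n = trans (ω-unfold (n * 2)) (cong₂ _+_ (m*n%n≡0 n 2) (cong ω (m*n/n≡m n 2)))

ω[1+n*2]≡1+ω[n] : ∀ n → ω (suc (n * 2)) ≡ suc (ω n)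
ω[1+n*2]≡1+ω[n] n = trans (ω-unfold (suc (n * 2)))
  (cong₂ _+_ ([m+kn]%n≡m%n 1 n 2) (cong ω (trans (+-distrib-/ 1 (n * 2) carry-free) (m*n/n≡m n 2))))
  where
  carry-free : 1 % 2 + n * 2 % 2 < 2
  carry-free = subst (λ x → 1 + x < 2) (sym (m*n%n≡0 n 2)) (s≤s (s≤s z≤n))

-- A binary expansion of n (leading zeros allowed); recursion on it is structural
-- recursion along n / 2, the recursion that ω unfolds.
data Binary : ℕ → Set where
  zero : Binary 0
  bit0 : ∀ {n} → Binary n → Binary (n * 2)
  bit1 : ∀ {n} → Binary n → Binary (suc (n * 2))

Binary-suc : ∀ {n} → Binary n → Binary (suc n)
Binary-suc zero = bit1 zero
Binary-suc (bit0 b) = bit1 b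
Binary-suc (bit1 b) = bit0 (Binary-suc b)

binary : ∀ n → Binary n
binary zero = zero
binary (suc n) = Binary-suc (binary n)

ω[1+n]≤1+ω[n] : ∀ {n} → Binary n → ω (suc n) ≤ suc (ω n)
ω[1+n]≤1+ω[n] zero = ≤-refl
ω[1+n]≤1+ω[n] (bit0 {n} _) =
  ≤-reflexive (trans (ω[1+n*2]≡1+ω[n] n) (cong suc (sym (ω[n*2]≡ω[n] n))))
ω[1+n]≤1+ω[n] (bit1 {n} b) = begin
  ω (suc n * 2)        ≡⟨ ω[n*2]≡ω[n] (suc n) ⟩
  ω (suc n)            ≤⟨ ω[1+n]≤1+ω[n] b ⟩
  suc (ω n)            ≤⟨ n≤1+n _ ⟩
  suc (suc (ω n))      ≡⟨ cong suc (ω[1+n*2]≡1+ω[n] n) ⟨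
  suc (ω (suc (n * 2))) ∎
  where open ≤-Reasoning

ω[m+n]≤ω[m]+ω[n] : ∀ m n → ω (m + n) ≤ ω m + ω n
ω[m+n]≤ω[m]+ω[n] m n = go (binary m) (binary n)
  where
  open ≤-Reasoning
  halves : ∀ m n → m * 2 + n * 2 ≡ (m + n) * 2
  halves m n = sym (*-distribʳ-+ 2 m n)

  go : ∀ {m n} → Binary m → Binary n → ω (m + n) ≤ ω m + ω n
  go zero _ = ≤-refl
  go {m} b zero = ≤-trans (≤-reflexive (cong ω (+-identityʳ m))) (m≤m+n (ω m) 0)
  go (bit0 {m} bm) (bit0 {n} bn) = begin
    ω (m * 2 + n * 2)         ≡⟨ cong ω (halves m n) ⟩
    ω ((m + n) * 2)           ≡⟨ ω[n*2]≡ω[n] (m + n) ⟩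
    ω (m + n)                 ≤⟨ go bm bn ⟩
    ω m + ω n                 ≡⟨ cong₂ _+_ (ω[n*2]≡ω[n] m) (ω[n*2]≡ω[n] n) ⟨
    ω (m * 2) + ω (n * 2)     ∎
  go (bit0 {m} bm) (bit1 {n} bn) = begin
    ω (m * 2 + suc (n * 2))   ≡⟨ cong ω (trans (+-suc (m * 2) (n * 2)) (cong suc (halves m n))) ⟩
    ω (suc ((m + n) * 2))     ≡⟨ ω[1+n*2]≡1+ω[n] (m + n) ⟩
    suc (ω (m + n))           ≤⟨ s≤s (go bm bn) ⟩
    suc (ω m + ω n)           ≡⟨ +-suc (ω m) (ω n) ⟨
    ω m + suc (ω n)           ≡⟨ cong₂ _+_ (ω[n*2]≡ω[n] m) (ω[1+n*2]≡1+ω[n] n) ⟨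
    ω (m * 2) + ω (suc (n * 2)) ∎
  go (bit1 {m} bm) (bit0 {n} bn) = begin
    ω (suc (m * 2 + n * 2))   ≡⟨ cong (ω ∘ suc) (halves m n) ⟩
    ω (suc ((m + n) * 2))     ≡⟨ ω[1+n*2]≡1+ω[n] (m + n) ⟩
    suc (ω (m + n))           ≤⟨ s≤s (go bm bn) ⟩
    suc (ω m + ω n)           ≡⟨ cong₂ _+_ (ω[1+n*2]≡1+ω[n] m) (ω[n*2]≡ω[n] n) ⟨
    ω (suc (m * 2)) + ω (n * 2) ∎
  go (bit1 {m} bm) (bit1 {n} bn) = begin
    ω (suc (m * 2 + suc (n * 2))) ≡⟨ cong (ω ∘ suc) (trans (+-suc (m * 2) (n * 2)) (cong suc (halves m n))) ⟩
    ω (suc (m + n) * 2)       ≡⟨ ω[n*2]≡ω[n] (suc (m + n)) ⟩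
    ω (suc (m + n))           ≤⟨ ω[1+n]≤1+ω[n] (binary (m + n)) ⟩
    suc (ω (m + n))           ≤⟨ s≤s (go bm bn) ⟩
    suc (ω m + ω n)           ≤⟨ s≤s (+-monoʳ-≤ (ω m) (n≤1+n (ω n))) ⟩
    suc (ω m + suc (ω n))     ≡⟨ cong₂ _+_ (ω[1+n*2]≡1+ω[n] m) (ω[1+n*2]≡1+ω[n] n) ⟨
    ω (suc (m * 2)) + ω (suc (n * 2)) ∎

n*2<2^[1+k]⇒n<2^k : ∀ {n} k → n * 2 < 2 ^ suc k → n < 2 ^ k
n*2<2^[1+k]⇒n<2^k {n} k lt = *-cancelʳ-< 2 n (2 ^ k) (subst (n * 2 <_) (*-comm 2 (2 ^ k)) lt)

ω[2^k*m+r]≡ω[m]+ω[r] : ∀ k m {r} → r < 2 ^ k → ω (2 ^ k * m + r) ≡ ω m + ω r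
ω[2^k*m+r]≡ω[m]+ω[r] k m {r} = go k (binary r)
  where
  open ≡-Reasoning
  shift : ∀ k r → 2 ^ suc k * m + r * 2 ≡ (2 ^ k * m + r) * 2
  shift k r = solve 3 (λ p m r → con 2 :* p :* m :+ r :* con 2 := (p :* m :+ r) :* con 2) refl (2 ^ k) m r

  go : ∀ k {r} → Binary r → r < 2 ^ k → ω (2 ^ k * m + r) ≡ ω m + ω r
  go zero _ (s≤s z≤n) = trans (cong ω (trans (+-identityʳ (m + 0)) (+-identityʳ m))) (sym (+-identityʳ (ω m)))
  go (suc k) zero _ = begin
    ω (2 ^ suc k * m + 0)    ≡⟨ cong ω (shift k 0) ⟩
    ω ((2 ^ k * m + 0) * 2)  ≡⟨ ω[n*2]≡ω[n] (2 ^ k * m + 0) ⟩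
    ω (2 ^ k * m + 0)        ≡⟨ go k zero (m^n>0 2 k) ⟩
    ω m + 0                  ∎
  go (suc k) (bit0 {r} b) lt = begin
    ω (2 ^ suc k * m + r * 2) ≡⟨ cong ω (shift k r) ⟩
    ω ((2 ^ k * m + r) * 2)   ≡⟨ ω[n*2]≡ω[n] (2 ^ k * m + r) ⟩
    ω (2 ^ k * m + r)         ≡⟨ go k b (n*2<2^[1+k]⇒n<2^k k lt) ⟩
    ω m + ω r                 ≡⟨ cong (ω m +_) (ω[n*2]≡ω[n] r) ⟨
    ω m + ω (r * 2)           ∎
  go (suc k) (bit1 {r} b) lt = begin
    ω (2 ^ suc k * m + suc (r * 2)) ≡⟨ cong ω (trans (+-suc _ (r * 2)) (cong suc (shift k r))) ⟩
    ω (suc ((2 ^ k * m + r) * 2))   ≡⟨ ω[1+n*2]≡1+ω[n] (2 ^ k * m + r) ⟩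
    suc (ω (2 ^ k * m + r))         ≡⟨ cong suc (go k b (n*2<2^[1+k]⇒n<2^k k (<⇒≤ lt))) ⟩
    suc (ω m + ω r)                 ≡⟨ +-suc (ω m) (ω r) ⟨
    ω m + suc (ω r)                 ≡⟨ cong (ω m +_) (ω[1+n*2]≡1+ω[n] r) ⟨
    ω m + ω (suc (r * 2))           ∎

ω[2^k+r]≡1+ω[r] : ∀ k {r} → r < 2 ^ k → ω (2 ^ k + r) ≡ suc (ω r)
ω[2^k+r]≡1+ω[r] k {r} lt =
  trans (cong (λ p → ω (p + r)) (sym (*-identityʳ (2 ^ k)))) (ω[2^k*m+r]≡ω[m]+ω[r] k 1 lt)

data LeadingPowerOf2 : ℕ → Set where
  2^_+_[_] : ∀ k r → r < 2 ^ k → LeadingPowerOf2 (2 ^ k + r)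

LeadingPowerOf2-suc : ∀ {n} → LeadingPowerOf2 n → LeadingPowerOf2 (suc n)
LeadingPowerOf2-suc 2^ k + r [ r<2^k ] with m≤n⇒m<n∨m≡n r<2^k
... | inj₁ 1+r<2^k = subst LeadingPowerOf2 (+-suc (2 ^ k) r) 2^ k + suc r [ 1+r<2^k ]
... | inj₂ 1+r≡2^k = subst LeadingPowerOf2 carry 2^ suc k + 0 [ m^n>0 2 (suc k) ]
  where
  carry : 2 ^ suc k + 0 ≡ suc (2 ^ k + r)
  carry = begin
    2 ^ suc k + 0          ≡⟨ +-identityʳ (2 ^ suc k) ⟩
    2 ^ k + (2 ^ k + 0)    ≡⟨ cong (2 ^ k +_) (+-identityʳ (2 ^ k)) ⟩
    2 ^ k + 2 ^ k          ≡⟨ cong (2 ^ k +_) 1+r≡2^k ⟨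
    2 ^ k + suc r          ≡⟨ +-suc (2 ^ k) r ⟩
    suc (2 ^ k + r)        ∎
    where open ≡-Reasoning

leadingPowerOf2 : ∀ n → 0 < n → LeadingPowerOf2 n
leadingPowerOf2 (suc zero) _ = 2^ 0 + 0 [ z<s ]
leadingPowerOf2 (suc (suc n)) _ = LeadingPowerOf2-suc (leadingPowerOf2 (suc n) z<s)

0<ω : ∀ n → 0 < n → 0 < ω n
0<ω n 0<n with leadingPowerOf2 n 0<n
... | 2^ k + r [ r<2^k ] = subst (0 <_) (sym (ω[2^k+r]≡1+ω[r] k r<2^k)) z<s

0<leaves : ∀ t → 0 < leaves t
0<leaves leaf = z<s
0<leaves (node l r) = ≤-trans (0<leaves l) (m≤m+n (leaves l) (leaves r))

snodes-S-node : ∀ {l r} → leaves l ≡ leaves r → snodes (node l r) ≡ suc (snodes l + snodes r)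
snodes-S-node {l} {r} l≡r with leaves l ≟ leaves r
... | yes _ = refl
... | no l≢r = ⊥-elim (l≢r l≡r)

snodes-D-node : ∀ {l r} → leaves l ≢ leaves r → snodes (node l r) ≡ snodes l + snodes r
snodes-D-node {l} {r} l≢r with leaves l ≟ leaves r
... | yes l≡r = ⊥-elim (l≢r l≡r)
... | no _ = refl

S-node-bound : ∀ {sl sr a b} → a ≡ b → 0 < ω a → sl + ω a ≤ a → sr + ω b ≤ b → suc (sl + sr) + ω (a + b) ≤ a + b
S-node-bound {sl} {sr} {a} refl 0<ωa l-bound r-bound = begin
  suc (sl + sr) + ω (a + a)     ≡⟨ cong (λ x → suc (sl + sr) + ω x) (a+a≡a*2 a) ⟩
  suc (sl + sr) + ω (a * 2)     ≡⟨ cong (suc (sl + sr) +_) (ω[n*2]≡ω[n] a) ⟩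
  suc (sl + sr) + ω a           ≡⟨ solve 3 (λ x y w → con 1 :+ (x :+ y) :+ w := x :+ (y :+ w) :+ con 1) refl sl sr (ω a) ⟩
  sl + (sr + ω a) + 1           ≤⟨ +-monoʳ-≤ (sl + (sr + ω a)) 0<ωa ⟩
  sl + (sr + ω a) + ω a         ≡⟨ solve 3 (λ x y w → x :+ (y :+ w) :+ w := (x :+ w) :+ (y :+ w)) refl sl sr (ω a) ⟩
  (sl + ω a) + (sr + ω a)       ≤⟨ +-mono-≤ l-bound r-bound ⟩
  a + a                         ∎
  where
  open ≤-Reasoning
  a+a≡a*2 : ∀ a → a + a ≡ a * 2
  a+a≡a*2 a = solve 1 (λ a → a :+ a := a :* con 2) refl a

D-node-bound : ∀ {sl sr a b} → sl + ω a ≤ a → sr + ω b ≤ b → sl + sr + ω (a + b) ≤ a + b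
D-node-bound {sl} {sr} {a} {b} l-bound r-bound = begin
  sl + sr + ω (a + b)           ≤⟨ +-monoʳ-≤ (sl + sr) (ω[m+n]≤ω[m]+ω[n] a b) ⟩
  sl + sr + (ω a + ω b)         ≡⟨ solve 4 (λ x y u v → x :+ y :+ (u :+ v) := (x :+ u) :+ (y :+ v)) refl sl sr (ω a) (ω b) ⟩
  (sl + ω a) + (sr + ω b)       ≤⟨ +-mono-≤ l-bound r-bound ⟩
  a + b                         ∎
  where open ≤-Reasoning

snodes+ω[leaves]≤leaves : ∀ t → snodes t + ω (leaves t) ≤ leaves t
snodes+ω[leaves]≤leaves leaf = ≤-refl
snodes+ω[leaves]≤leaves (node l r) with leaves l ≟ leaves r
... | yes l≡r = S-node-bound l≡r (0<ω (leaves l) (0<leaves l))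
  (snodes+ω[leaves]≤leaves l) (snodes+ω[leaves]≤leaves r)
... | no _ = D-node-bound (snodes+ω[leaves]≤leaves l) (snodes+ω[leaves]≤leaves r)

leaves-perfect : ∀ k → leaves (perfect k) ≡ 2 ^ k
leaves-perfect zero = refl
leaves-perfect (suc k) = cong₂ _+_ (leaves-perfect k) (trans (leaves-perfect k) (sym (+-identityʳ (2 ^ k))))

snodes-perfect : ∀ k → snodes (perfect k) + 1 ≡ 2 ^ k
snodes-perfect zero = refl
snodes-perfect (suc k) = begin
  snodes (node (perfect k) (perfect k)) + 1 ≡⟨ cong (_+ 1) (snodes-S-node {perfect k} {perfect k} refl) ⟩
  suc (s + s) + 1                           ≡⟨ solve 1 (λ s → con 1 :+ (s :+ s) :+ con 1 := (s :+ con 1) :+ ((s :+ con 1) :+ con 0)) refl s ⟩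
  (s + 1) + ((s + 1) + 0)                   ≡⟨ cong (λ p → p + (p + 0)) (snodes-perfect k) ⟩
  2 ^ suc k                                 ∎
  where
  open ≡-Reasoning
  s = snodes (perfect k)

⌊n/2⌋<m : ∀ {n m} → n < 2 * m → ⌊ n /2⌋ < m
⌊n/2⌋<m {n} {m} n<2m = *-cancelˡ-< 2 ⌊ n /2⌋ m (begin-strict
  2 * ⌊ n /2⌋           ≡⟨ cong (⌊ n /2⌋ +_) (+-identityʳ ⌊ n /2⌋) ⟩
  ⌊ n /2⌋ + ⌊ n /2⌋     ≤⟨ +-monoʳ-≤ ⌊ n /2⌋ (⌊n/2⌋≤⌈n/2⌉ n) ⟩
  ⌊ n /2⌋ + ⌈ n /2⌉     ≡⟨ ⌊n/2⌋+⌈n/2⌉≡n n ⟩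
  n                     <⟨ n<2m ⟩
  2 * m                 ∎)
  where open ≤-Reasoning

⌊2*m+n/2⌋≡m+⌊n/2⌋ : ∀ m n → ⌊ 2 * m + n /2⌋ ≡ m + ⌊ n /2⌋
⌊2*m+n/2⌋≡m+⌊n/2⌋ zero n = refl
⌊2*m+n/2⌋≡m+⌊n/2⌋ (suc m) n =
  trans (cong (λ x → ⌊ x + n /2⌋) (*-suc 2 m)) (cong suc (⌊2*m+n/2⌋≡m+⌊n/2⌋ m n))

⌊log₂[2^k+r]⌋≡k : ∀ k {r} → r < 2 ^ k → ⌊log₂ (2 ^ k + r) ⌋ ≡ k
⌊log₂[2^k+r]⌋≡k zero (s≤s z≤n) = refl
⌊log₂[2^k+r]⌋≡k (suc k) {r} r<2^[1+k] = begin
  L             ≡⟨ m∸n+n≡m (≤-trans (s≤s z≤n) 1+k≤L) ⟨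
  L ∸ 1 + 1     ≡⟨ cong (_+ 1) L∸1≡k ⟩
  k + 1         ≡⟨ +-comm k 1 ⟩
  suc k         ∎
  where
  open ≡-Reasoning
  L = ⌊log₂ (2 ^ suc k + r) ⌋
  1+k≤L : suc k ≤ L
  1+k≤L = subst (_≤ L) (⌊log₂[2^n]⌋≡n (suc k)) (⌊log₂⌋-mono-≤ (m≤m+n (2 ^ suc k) r))
  L∸1≡k : L ∸ 1 ≡ k
  L∸1≡k = begin
    L ∸ 1                          ≡⟨ ⌊log₂⌊n/2⌋⌋≡⌊log₂n⌋∸1 (2 ^ suc k + r) ⟨
    ⌊log₂ ⌊ 2 ^ suc k + r /2⌋ ⌋    ≡⟨ cong ⌊log₂_⌋ (⌊2*m+n/2⌋≡m+⌊n/2⌋ (2 ^ k) r) ⟩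
    ⌊log₂ (2 ^ k + ⌊ r /2⌋) ⌋      ≡⟨ ⌊log₂[2^k+r]⌋≡k k (⌊n/2⌋<m r<2^[1+k]) ⟩
    k                              ∎

-- The rewrites reach only the with-scrutinee of optTreeFuel; its clauses recompute
-- ⌊log₂ n ⌋, hence the final cong.
optTreeFuel-perfect : ∀ f k → optTreeFuel (suc f) (2 ^ k + 0) ≡ perfect k
optTreeFuel-perfect f k rewrite ⌊log₂[2^k+r]⌋≡k k (m^n>0 2 k) | m+n∸m≡n (2 ^ k) 0 =
  cong perfect (⌊log₂[2^k+r]⌋≡k k (m^n>0 2 k))

optTreeFuel-node : ∀ f k {r} → suc r < 2 ^ k →
  optTreeFuel (suc f) (2 ^ k + suc r) ≡ node (perfect k) (optTreeFuel f (suc r))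
optTreeFuel-node f k {r} 1+r<2^k rewrite ⌊log₂[2^k+r]⌋≡k k 1+r<2^k | m+n∸m≡n (2 ^ k) (suc r) =
  cong (λ j → node (perfect j) (optTreeFuel f (suc r))) (⌊log₂[2^k+r]⌋≡k k 1+r<2^k)

optTreeFuel-irrelevant : ∀ {f g n} → n ≤ f → n ≤ g → optTreeFuel f n ≡ optTreeFuel g n
optTreeFuel-irrelevant {zero} {zero} _ _ = refl
optTreeFuel-irrelevant {zero} {suc g} z≤n _ = refl
optTreeFuel-irrelevant {suc f} {zero} _ z≤n = refl
optTreeFuel-irrelevant {suc f} {suc g} {n} n≤1+f n≤1+g with n ∸ 2 ^ ⌊log₂ n ⌋ in eq
... | zero = refl
... | suc r = cong (node (perfect ⌊log₂ n ⌋)) (optTreeFuel-irrelevant (bound n≤1+f) (bound n≤1+g))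
  where
  bound : ∀ {f} → n ≤ suc f → suc r ≤ f
  bound n≤1+f = ≤-trans (≤-reflexive (sym eq)) (≤-trans (∸-monoʳ-≤ n (m^n>0 2 ⌊log₂ n ⌋)) (∸-monoˡ-≤ 1 n≤1+f))

optTree≡optTreeFuel : ∀ n {f} → n ≤ f → optTree n ≡ optTreeFuel f n
optTree≡optTreeFuel n = optTreeFuel-irrelevant {n} ≤-refl

optTree-perfect : ∀ k → optTree (2 ^ k + 0) ≡ perfect k
optTree-perfect k = trans (optTree≡optTreeFuel (2 ^ k + 0) (n≤1+n _)) (optTreeFuel-perfect _ k)

optTree-node : ∀ k {r} → suc r < 2 ^ k → optTree (2 ^ k + suc r) ≡ node (perfect k) (optTree (suc r))
optTree-node k {r} 1+r<2^k = begin
  optTree n                                ≡⟨ optTree≡optTreeFuel n (n≤1+n n) ⟩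
  optTreeFuel (suc n) n                    ≡⟨ optTreeFuel-node n k 1+r<2^k ⟩
  node (perfect k) (optTreeFuel n (suc r)) ≡⟨ cong (node (perfect k)) (optTree≡optTreeFuel (suc r) (m≤n+m (suc r) (2 ^ k))) ⟨
  node (perfect k) (optTree (suc r))       ∎
  where
  open ≡-Reasoning
  n = 2 ^ k + suc r

Optimal : Tree → Set
Optimal t = snodes t + ω (leaves t) ≡ leaves t

perfect-optimal : ∀ k → Optimal (perfect k)
perfect-optimal k = subst (λ n → snodes (perfect k) + ω n ≡ n) (sym (leaves-perfect k)) (begin
  snodes (perfect k) + ω (2 ^ k)     ≡⟨ cong (λ n → snodes (perfect k) + ω n) (+-identityʳ (2 ^ k)) ⟨
  snodes (perfect k) + ω (2 ^ k + 0) ≡⟨ cong (snodes (perfect k) +_) (ω[2^k+r]≡1+ω[r] k (m^n>0 2 k)) ⟩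
  snodes (perfect k) + 1             ≡⟨ snodes-perfect k ⟩
  2 ^ k                              ∎)
  where open ≡-Reasoning

node-perfect-optimal : ∀ k {t} → leaves t < 2 ^ k → Optimal t → Optimal (node (perfect k) t)
node-perfect-optimal k {t} t<2^k t-optimal = begin
  snodes (node P t) + ω (leaves P + s)  ≡⟨ cong₂ _+_ (snodes-D-node {P} {t} P≢t) (cong (λ p → ω (p + s)) (leaves-perfect k)) ⟩
  snodes P + snodes t + ω (2 ^ k + s)   ≡⟨ cong (snodes P + snodes t +_) (ω[2^k+r]≡1+ω[r] k t<2^k) ⟩
  snodes P + snodes t + suc (ω s)       ≡⟨ solve 3 (λ p q w → p :+ q :+ (con 1 :+ w) := (p :+ con 1) :+ (q :+ w)) refl (snodes P) (snodes t) (ω s) ⟩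
  (snodes P + 1) + (snodes t + ω s)     ≡⟨ cong₂ _+_ (snodes-perfect k) t-optimal ⟩
  2 ^ k + s                             ≡⟨ cong (_+ s) (leaves-perfect k) ⟨
  leaves P + s                          ∎
  where
  open ≡-Reasoning
  P = perfect k
  s = leaves t
  P≢t : leaves P ≢ s
  P≢t = >⇒≢ t<2^k ∘ trans (sym (leaves-perfect k))

optTreeFuel-optimal : ∀ f n → 0 < n → n ≤ f → leaves (optTreeFuel f n) ≡ n × Optimal (optTreeFuel f n)
optTreeFuel-optimal zero _ () z≤n
optTreeFuel-optimal (suc f) n 0<n n≤1+f with leadingPowerOf2 n 0<n
... | 2^ k + zero [ _ ] rewrite optTreeFuel-perfect f k =
  trans (leaves-perfect k) (sym (+-identityʳ (2 ^ k))) , perfect-optimal k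
... | 2^ k + suc r [ 1+r<2^k ] rewrite optTreeFuel-node f k 1+r<2^k
  with optTreeFuel-optimal f (suc r) z<s (s≤s⁻¹ (≤-trans (+-monoˡ-≤ (suc r) (m^n>0 2 k)) n≤1+f))
...   | leaves≡1+r , optimal =
  cong₂ _+_ (leaves-perfect k) leaves≡1+r ,
  node-perfect-optimal k (subst (_< 2 ^ k) (sym leaves≡1+r) 1+r<2^k) optimal

snodes≤leaves∸ω[leaves] : ∀ t → snodes t ≤ leaves t ∸ ω (leaves t)
snodes≤leaves∸ω[leaves] t = m+n≤o⇒m≤o∸n (snodes t) (snodes+ω[leaves]≤leaves t)

Optimal⇒snodes≡leaves∸ω[leaves] : ∀ t → Optimal t → snodes t ≡ leaves t ∸ ω (leaves t)
Optimal⇒snodes≡leaves∸ω[leaves] t optimal =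
  trans (sym (m+n∸n≡m (snodes t) (ω (leaves t)))) (cong (_∸ ω (leaves t)) optimal)

corollary76 : ∀ (k r : ℕ) → r < 2 ^ k →
    -- upper bound: every full binary tree with n leaves has ≤ n - ω(n) S-nodes
    (∀ (t : Tree) → leaves t ≡ 2 ^ k + r → snodes t ≤ (2 ^ k + r) ∸ ω (2 ^ k + r))
    -- the bound is attained, so it is the maximum
    × (∃[ t ] (leaves t ≡ 2 ^ k + r × snodes t ≡ (2 ^ k + r) ∸ ω (2 ^ k + r)))
    -- the described construction: optTree n is perfect k if r = 0, and otherwise the join of perfect k and optTree r
    × (r ≡ 0 → optTree (2 ^ k + r) ≡ perfect k)
    × (0 < r → optTree (2 ^ k + r) ≡ node (perfect k) (optTree r))
    -- and it has n leaves and n - ω(n) S-nodes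
    × leaves (optTree (2 ^ k + r)) ≡ 2 ^ k + r
    × snodes (optTree (2 ^ k + r)) ≡ (2 ^ k + r) ∸ ω (2 ^ k + r)
corollary76 k r r<2^k =
  upper-bound , (optTree n , leaves≡n , snodes≡n∸ωn) ,
  (λ { refl → optTree-perfect k }) , (λ { z<s → optTree-node k r<2^k }) ,
  leaves≡n , snodes≡n∸ωn
  where
  n = 2 ^ k + r
  upper-bound : ∀ t → leaves t ≡ n → snodes t ≤ n ∸ ω n
  upper-bound t leaves≡n = subst (λ m → snodes t ≤ m ∸ ω m) leaves≡n (snodes≤leaves∸ω[leaves] t)
  construction = optTreeFuel-optimal n n (≤-trans (m^n>0 2 k) (m≤m+n (2 ^ k) r)) ≤-refl
  leaves≡n = proj₁ construction
  snodes≡n∸ωn : snodes (optTree n) ≡ n ∸ ω n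
  snodes≡n∸ωn = subst (λ m → snodes (optTree n) ≡ m ∸ ω m) leaves≡n
    (Optimal⇒snodes≡leaves∸ω[leaves] (optTree n) (proj₂ construction))
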